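{- For any $b\ge2$, $i\in I$ and $n\ge2$, there are integers $c,k$ with $1\le c\le b-1$ and $0\le k\le(b-1)B(n)-2$ such that $K_i(n)=c\,(b^{B(n)}+1)+k$. Furthermore, if $b$ is odd then $c\le\frac{b-1}{2}$.
   Context: Fix a base $b\ge2$. For $v\in\mathbb{N}$, $s(v)$ is the sum of the base-$b$ digits of $v$, $f(v)=v+s(v)$, and $F(u)=|\{v\in\mathbb{N}: f(v)=u\}|$. $K(n)$ is the smallest $u\in\mathbb{N}$ with $F(u)=n$, and for $n\ge2$, $B(n)=\lfloor\log_b K(n)\rfloor$ (so $K(n)=b^{B(n)}+$ lower-order terms). The index set $I$ is the set of residue classes modulo $b-1$ if $b$ is even, and the set of even residue classes $\{0,2,4,\dots,b-3\}$ modulo $b-1$ if $b$ is odd. For $i\in I$, $K_i(n)$ is the smallest $u\in\mathbb{N}$ with $F(u)=n$ and $u\equiv i\pmod{b-1}$. -}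

module Defs where

open import Data.Nat using (ℕ; zero; suc; _+_; _*_; _∸_; _^_; _≤_; _<_; NonZero)
open import Data.Nat.Properties using (_≟_)
open import Data.Nat.DivMod using (_/_; _%_)
open import Data.List using (List; length; filter; upTo)
open import Data.Product using (_×_; ∃)
open import Relation.Binary.PropositionalEquality using (_≡_)
open import Relation.Nullary using (¬_)

-- base-b digit sum with fuel; fuel v suffices since v / b < v for v > 0, b ≥ 2
digitSumAux : (b : ℕ) → .{{NonZero b}} → ℕ → ℕ → ℕ
digitSumAux b zero    v = 0
digitSumAux b (suc t) v = v % b + digitSumAux b t (v / b)

s : (b : ℕ) → .{{NonZero b}} → ℕ → ℕ
s b v = digitSumAux b v v

f : (b : ℕ) → .{{NonZero b}} → ℕ → ℕ
f b v = v + s b v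

-- F(u) = |{ v ∈ ℕ : f(v) = u }|; since f(v) ≥ v, every such v satisfies v ≤ u,
-- so it suffices to count over v ∈ {0,…,u}.
F : (b : ℕ) → .{{NonZero b}} → ℕ → ℕ
F b u = length (filter (λ v → f b v ≟ u) (upTo (suc u)))

IsLeast : (ℕ → Set) → ℕ → Set
IsLeast P u = P u × (∀ w → w < u → ¬ P w)

-- u ≡ i (mod m)  (used with 0 ≤ i < m): u = q*m + i for some q
CongMod : ℕ → ℕ → ℕ → Set
CongMod u i m = ∃ λ q → u ≡ q * m + i

-- the index set I (residues mod b-1, represented by 0 ≤ i < b-1;
-- if b is odd only the even ones, i.e. i ∈ {0,2,…,b-3})
InI : ℕ → ℕ → Set
InI b i = i < b ∸ 1 × (b % 2 ≡ 1 → i % 2 ≡ 0)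

IsFloorLog : ℕ → ℕ → ℕ → Set
IsFloorLog b K B = b ^ B ≤ K × K < b ^ suc B

module Submission where

-- Let P = b^d. Writing v = q·P + w with q < b and w < P gives f(v) = q(P + 1) + f(w) with
-- f(w) < 2P, so a number u = c(P + 1) + k ≤ bP with 1 ≤ c and k ≤ P has exactly
-- F(k) + #{w < P : f(w) = k + P + 1} preimages, whatever its leading digit c is.
-- Minimality of K gives F(k) ≠ n for all k ≤ P; hence for K, and again for K_i, the second
-- count is nonzero, and a preimage w of k + P + 1 yields k + 2 ≤ (b − 1)d because
-- s(w) ≤ (b − 1)d. Modulo b − 1 we have P ≡ 1 and w ≡ s(w), so u + P + 1 ≡ 2c + 2s(w).
-- Replacing the leading digit of K by a solution c of 2c + 2s(w) ≡ i + 2 (2 is invertible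
-- when b is even; when b is odd, i is even and c can be taken ≤ (b − 1)/2) gives a number
-- ≡ i with F = n that still lies below b^(d+1) (for even b this needs d ≥ 2: when d = 1 the
-- two counts cannot both be nonzero, by parity). So K_i has the same shape, with leading
-- digit at most c.

open import Defs
open import Data.Empty using (⊥-elim)
open import Data.List using (length; filter; applyUpTo)
open import Data.Nat
open import Data.Nat.DivMod
open import Data.Nat.Induction using (<-rec)
open import Data.Nat.Properties
open import Data.Nat.Tactic.RingSolver using (solve-∀)
open import Data.Product using (∃; ∃₂; _×_; _,_; proj₁; proj₂)
open import Data.Sum using (_⊎_; inj₁; inj₂; [_,_]′)
open import Function using (id; _∘_)
open import Level using (0ℓ)
open import Relation.Binary.PropositionalEquality
open import Relation.Nullary using (¬_; yes; no; contradiction)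
open import Relation.Unary using (Pred; Decidable)

private variable
  Φ Ψ : Pred ℕ 0ℓ

count : Decidable Φ → ℕ → ℕ
count Φ? zero = 0
count Φ? (suc n) with Φ? 0
... | yes _ = suc (count (λ i → Φ? (suc i)) n)
... | no  _ = count (λ i → Φ? (suc i)) n

length-filter-applyUpTo : (Φ? : Decidable Φ) (h : ℕ → ℕ) (n : ℕ) →
  length (filter Φ? (applyUpTo h n)) ≡ count (λ i → Φ? (h i)) n
length-filter-applyUpTo Φ? h zero    = refl
length-filter-applyUpTo Φ? h (suc n) with Φ? (h 0)
... | yes _ = cong suc (length-filter-applyUpTo Φ? (λ i → h (suc i)) n)
... | no  _ = length-filter-applyUpTo Φ? (λ i → h (suc i)) n

count-+ : (Φ? : Decidable Φ) (m n : ℕ) →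
  count Φ? (m + n) ≡ count Φ? m + count (λ i → Φ? (m + i)) n
count-+ Φ? zero    _ = refl
count-+ Φ? (suc m) n with Φ? 0
... | yes _ = cong suc (count-+ (λ i → Φ? (suc i)) m n)
... | no  _ = count-+ (λ i → Φ? (suc i)) m n

count-none : (Φ? : Decidable Φ) (n : ℕ) → (∀ i → i < n → ¬ Φ i) → count Φ? n ≡ 0
count-none Φ? zero    _ = refl
count-none Φ? (suc n) none with Φ? 0
... | yes p = contradiction p (none 0 z<s)
... | no  _ = count-none (λ i → Φ? (suc i)) n (λ i i<n → none (suc i) (s<s i<n))

count≢0⇒∃ : (Φ? : Decidable Φ) (n : ℕ) → count Φ? n ≢ 0 → ∃ λ i → i < n × Φ i
count≢0⇒∃ Φ? zero    count≢0 = ⊥-elim (count≢0 refl)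
count≢0⇒∃ Φ? (suc n) count≢0 with Φ? 0
... | yes p = 0 , z<s , p
... | no  _ with count≢0⇒∃ (λ i → Φ? (suc i)) n count≢0
...   | i , i<n , p = suc i , s<s i<n , p

count-≤1 : (Φ? : Decidable Φ) (n : ℕ) →
  (∀ {i j} → i < n → j < n → Φ i → Φ j → i ≡ j) → count Φ? n ≤ 1
count-≤1 Φ? zero    _ = z≤n
count-≤1 Φ? (suc n) unique with Φ? 0
... | yes p = s≤s (≤-reflexive (count-none (λ i → Φ? (suc i)) n
                (λ i i<n q → 0≢1+n (unique z<s (s<s i<n) p q))))
... | no  _ = count-≤1 (λ i → Φ? (suc i)) n
                (λ i<n j<n p q → suc-injective (unique (s<s i<n) (s<s j<n) p q))

count-truncate : (Φ? : Decidable Φ) {m n : ℕ} → m ≤ n →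
  (∀ i → m ≤ i → i < n → ¬ Φ i) → count Φ? n ≡ count Φ? m
count-truncate {Φ = Φ} Φ? {m} {n} m≤n none = begin
  count Φ? n                                     ≡⟨ cong (count Φ?) (m+[n∸m]≡n m≤n) ⟨
  count Φ? (m + (n ∸ m))                         ≡⟨ count-+ Φ? m (n ∸ m) ⟩
  count Φ? m + count (λ i → Φ? (m + i)) (n ∸ m)  ≡⟨ cong (count Φ? m +_) (count-none _ (n ∸ m) beyond) ⟩
  count Φ? m + 0                                 ≡⟨ +-identityʳ _ ⟩
  count Φ? m                                     ∎
  where
  open ≡-Reasoning
  beyond : ∀ i → i < n ∸ m → ¬ Φ (m + i)
  beyond i i<n∸m = none (m + i) (m≤m+n m i) (subst (m + i <_) (m+[n∸m]≡n m≤n) (+-monoʳ-< m i<n∸m))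

count-cong : (Φ? : Decidable Φ) (Ψ? : Decidable Ψ) (n : ℕ) →
  (∀ i → i < n → Φ i → Ψ i) → (∀ i → i < n → Ψ i → Φ i) → count Φ? n ≡ count Ψ? n
count-cong Φ? Ψ? zero    _ _ = refl
count-cong Φ? Ψ? (suc n) to from with Φ? 0 | Ψ? 0
... | yes _ | yes _ = cong suc (count-cong _ _ n (λ i i<n → to (suc i) (s<s i<n)) (λ i i<n → from (suc i) (s<s i<n)))
... | no  _ | no  _ = count-cong _ _ n (λ i i<n → to (suc i) (s<s i<n)) (λ i i<n → from (suc i) (s<s i<n))
... | yes p | no ¬q = contradiction (to 0 z<s p) ¬q
... | no ¬p | yes q = contradiction (from 0 z<s q) ¬p

divide-suc : ∀ p u → ∃₂ λ c k → k ≤ p × c * suc p + k ≡ u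
divide-suc p u = u / suc p , u % suc p , <⇒≤pred (m%n<n u (suc p)) ,
  sym (trans (m≡m%n+[m/n]*n u (suc p)) (+-comm (u % suc p) _))

lead-≤ : ∀ p {c₁ k₁ c k} → c₁ * suc p + k₁ ≤ c * suc p + k → k ≤ p → c₁ ≤ c
lead-≤ p {c₁} {k₁} {c} {k} u₁≤u k≤p = <⇒≤pred (*-cancelʳ-< (suc p) c₁ (suc c) (begin-strict
  c₁ * suc p         ≤⟨ m≤m+n _ k₁ ⟩
  c₁ * suc p + k₁    ≤⟨ u₁≤u ⟩
  c * suc p + k      <⟨ +-monoʳ-< (c * suc p) (s≤s k≤p) ⟩
  c * suc p + suc p  ≡⟨ +-comm (c * suc p) (suc p) ⟩
  suc c * suc p      ∎))
  where open ≤-Reasoning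

congMod-intro : ∀ {m} .{{_ : NonZero m}} {u i} p q → i < m → u + p * m ≡ i + q * m → CongMod u i m
congMod-intro {m} {u} {i} p q i<m u+pm≡i+qm = u / m , (begin
  u                  ≡⟨ m≡m%n+[m/n]*n u m ⟩
  u % m + u / m * m  ≡⟨ cong (_+ u / m * m) u%m≡i ⟩
  i + u / m * m      ≡⟨ +-comm i _ ⟩
  u / m * m + i      ∎)
  where
  open ≡-Reasoning
  u%m≡i : u % m ≡ i
  u%m≡i = begin
    u % m            ≡⟨ [m+kn]%n≡m%n u p m ⟨
    (u + p * m) % m  ≡⟨ cong (_% m) u+pm≡i+qm ⟩
    (i + q * m) % m  ≡⟨ [m+kn]%n≡m%n i q m ⟩
    i % m            ≡⟨ m<n⇒m%n≡m i<m ⟩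
    i                ∎

n%2≡0⊎n%2≡1 : ∀ n → n % 2 ≡ 0 ⊎ n % 2 ≡ 1
n%2≡0⊎n%2≡1 n with n % 2 | m%n<n n 2
... | 0           | _ = inj₁ refl
... | 1           | _ = inj₂ refl
... | suc (suc _) | s≤s (s≤s ())

n≡n%2+[n/2]*2 : ∀ n {r} → n % 2 ≡ r → n ≡ r + n / 2 * 2
n≡n%2+[n/2]*2 n n%2≡r = trans (m≡m%n+[m/n]*n n 2) (cong (_+ n / 2 * 2) n%2≡r)

module Digits (a : ℕ) where

  b : ℕ
  b = suc (suc a)

  1<b : 1 < b
  1<b = s<s z<s

  b^m>0 : ∀ m → 0 < b ^ m
  b^m>0 = m^n>0 b

  -- Digit sums

  /b≤fuel : ∀ t v → v ≤ suc t → v / b ≤ t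
  /b≤fuel t zero    _   = z≤n
  /b≤fuel t (suc v) v≤t = <⇒≤pred (≤-trans (m/n<m (suc v) b 1<b) v≤t)

  digitSumAux-0 : ∀ t → digitSumAux b t 0 ≡ 0
  digitSumAux-0 zero    = refl
  digitSumAux-0 (suc t) = digitSumAux-0 t

  digitSumAux-fuel : ∀ t t′ v → v ≤ t → v ≤ t′ → digitSumAux b t v ≡ digitSumAux b t′ v
  digitSumAux-fuel zero    t′       .0 z≤n _   = sym (digitSumAux-0 t′)
  digitSumAux-fuel (suc t) zero     .0 _   z≤n = digitSumAux-0 (suc t)
  digitSumAux-fuel (suc t) (suc t′) v v≤t v≤t′ =
    cong (v % b +_) (digitSumAux-fuel t t′ (v / b) (/b≤fuel t v v≤t) (/b≤fuel t′ v v≤t′))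

  s-step : ∀ v → s b v ≡ v % b + s b (v / b)
  s-step zero    = refl
  s-step (suc v) = cong (suc v % b +_)
    (digitSumAux-fuel v (suc v / b) (suc v / b) (/b≤fuel v (suc v) ≤-refl) ≤-refl)

  [r+tb]%b≡r : ∀ {r} t → r < b → (r + t * b) % b ≡ r
  [r+tb]%b≡r {r} t r<b = trans ([m+kn]%n≡m%n r t b) (m<n⇒m%n≡m r<b)

  [r+tb]/b≡t : ∀ {r} t → r < b → (r + t * b) / b ≡ t
  [r+tb]/b≡t {r} t r<b = begin
    (r + t * b) / b    ≡⟨ +-distrib-/ r (t * b) (subst (_< b) (sym r%b+tb%b≡r) r<b) ⟩
    r / b + t * b / b  ≡⟨ cong₂ _+_ (m<n⇒m/n≡0 r<b) (m*n/n≡m t b) ⟩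
    t                  ∎
    where
    open ≡-Reasoning
    r%b+tb%b≡r : r % b + t * b % b ≡ r
    r%b+tb%b≡r = trans (cong₂ _+_ (m<n⇒m%n≡m r<b) (m*n%n≡0 t b)) (+-identityʳ r)

  s-append : ∀ {r} t → r < b → s b (r + t * b) ≡ r + s b t
  s-append {r} t r<b =
    trans (s-step (r + t * b)) (cong₂ (λ x y → x + s b y) ([r+tb]%b≡r t r<b) ([r+tb]/b≡t t r<b))

  s-digit : ∀ {r} → r < b → s b r ≡ r
  s-digit {r} r<b = trans (cong (s b) (sym (+-identityʳ r))) (trans (s-append 0 r<b) (+-identityʳ r))

  /b<b^m : ∀ m {w} → w < b ^ suc m → w / b < b ^ m
  /b<b^m m {w} w<b^[1+m] = m<n*o⇒m/o<n (subst (w <_) (*-comm b (b ^ m)) w<b^[1+m])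

  s-concat : ∀ m q {w} → w < b ^ m → s b (q * b ^ m + w) ≡ s b q + s b w
  s-concat zero    q {.0} (s≤s z≤n) =
    trans (cong (s b) (trans (+-identityʳ _) (*-identityʳ q))) (sym (+-identityʳ _))
  s-concat (suc m) q {w} w<b^[1+m] = begin
    s b (q * b ^ suc m + w)                ≡⟨ cong (s b) split ⟩
    s b (w % b + (q * b ^ m + w / b) * b)  ≡⟨ s-append (q * b ^ m + w / b) (m%n<n w b) ⟩
    w % b + s b (q * b ^ m + w / b)        ≡⟨ cong (w % b +_) (s-concat m q (/b<b^m m w<b^[1+m])) ⟩
    w % b + (s b q + s b (w / b))          ≡⟨ lem₂ (w % b) (s b q) (s b (w / b)) ⟩
    s b q + (w % b + s b (w / b))          ≡⟨ cong (s b q +_) (s-step w) ⟨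
    s b q + s b w                          ∎
    where
    open ≡-Reasoning
    lem₁ : ∀ b q p r t → q * (b * p) + (r + t * b) ≡ r + (q * p + t) * b
    lem₁ = solve-∀
    lem₂ : ∀ x y z → x + (y + z) ≡ y + (x + z)
    lem₂ = solve-∀
    split : q * b ^ suc m + w ≡ w % b + (q * b ^ m + w / b) * b
    split = trans (cong (q * b ^ suc m +_) (m≡m%n+[m/n]*n w b)) (lem₁ b q (b ^ m) (w % b) (w / b))

  s≤[b∸1]*m : ∀ m {w} → w < b ^ m → s b w ≤ (b ∸ 1) * m
  s≤[b∸1]*m zero    {.0} (s≤s z≤n)  = z≤n
  s≤[b∸1]*m (suc m) {w}  w<b^[1+m] = begin
    s b w                  ≡⟨ s-step w ⟩
    w % b + s b (w / b)    ≤⟨ +-mono-≤ (<⇒≤pred (m%n<n w b)) (s≤[b∸1]*m m (/b<b^m m w<b^[1+m])) ⟩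
    (b ∸ 1) + (b ∸ 1) * m  ≡⟨ *-suc (b ∸ 1) m ⟨
    (b ∸ 1) * suc m        ∎
    where open ≤-Reasoning

  s>0 : ∀ {v} → 0 < v → 0 < s b v
  s>0 {v} = <-rec (λ v → 0 < v → 0 < s b v) step v
    where
    step : ∀ v → (∀ {u} → u < v → 0 < u → 0 < s b u) → 0 < v → 0 < s b v
    step v ih v>0 with v % b in v%b≡
    ... | suc r = subst (0 <_) (sym (trans (s-step v) (cong (_+ s b (v / b)) v%b≡))) z<s
    ... | zero  = subst (0 <_) (sym (trans (s-step v) (cong (_+ s b (v / b)) v%b≡)))
                    (ih (m/n<m v b {{>-nonZero v>0}} 1<b) (m≥n⇒m/n>0 b≤v))
      where
      b≤v : b ≤ v
      b≤v = ≮⇒≥ (λ v<b → <⇒≢ v>0 (sym (trans (sym (m<n⇒m%n≡m v<b)) v%b≡)))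

  s≡[mod-b∸1] : ∀ v → ∃ λ j → v ≡ s b v + (b ∸ 1) * j
  s≡[mod-b∸1] = <-rec (λ v → ∃ λ j → v ≡ s b v + (b ∸ 1) * j) step
    where
    step : ∀ v → (∀ {u} → u < v → ∃ λ j → u ≡ s b u + (b ∸ 1) * j) →
           ∃ λ j → v ≡ s b v + (b ∸ 1) * j
    step zero         _  = 0 , sym (*-zeroʳ (b ∸ 1))
    step v@(suc _) ih with ih (m/n<m v b 1<b)
    ... | j , v/b≡ = x + j * b , (begin
      v                                      ≡⟨ m≡m%n+[m/n]*n v b ⟩
      v % b + v / b * b                      ≡⟨ cong (λ y → v % b + y * b) v/b≡ ⟩
      v % b + (x + (b ∸ 1) * j) * b          ≡⟨ lem (b ∸ 1) (v % b) x j ⟩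
      v % b + x + (b ∸ 1) * (x + j * b)      ≡⟨ cong (_+ (b ∸ 1) * (x + j * b)) (s-step v) ⟨
      s b v + (b ∸ 1) * (x + j * b)          ∎)
      where
      open ≡-Reasoning
      x : ℕ
      x = s b (v / b)
      lem : ∀ m r x j → r + (x + m * j) * suc m ≡ r + x + m * (x + j * suc m)
      lem = solve-∀

  b^d≡1[mod-b∸1] : ∀ d → ∃ λ e → b ^ d ≡ 1 + (b ∸ 1) * e
  b^d≡1[mod-b∸1] d with s≡[mod-b∸1] (b ^ d)
  ... | e , bᵈ≡ = e , trans bᵈ≡ (cong (_+ (b ∸ 1) * e) s[bᵈ]≡1)
    where
    s[bᵈ]≡1 : s b (b ^ d) ≡ 1
    s[bᵈ]≡1 = begin
      s b (b ^ d)          ≡⟨ cong (s b) (trans (+-identityʳ (1 * b ^ d)) (*-identityˡ (b ^ d))) ⟨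
      s b (1 * b ^ d + 0)  ≡⟨ s-concat d 1 (b^m>0 d) ⟩
      s b 1 + s b 0        ≡⟨ cong (_+ 0) (s-digit 1<b) ⟩
      1                    ∎
      where open ≡-Reasoning

  -- Bernoulli-type bounds

  b^m+[b∸1]≤b^[1+m] : ∀ m → b ^ m + (b ∸ 1) ≤ b ^ suc m
  b^m+[b∸1]≤b^[1+m] m = +-monoʳ-≤ (b ^ m) (m≤m*n (b ∸ 1) (b ^ m) {{>-nonZero (b^m>0 m)}})

  1+[b∸1]*m≤b^m : ∀ m → 1 + (b ∸ 1) * m ≤ b ^ m
  1+[b∸1]*m≤b^m zero    = ≤-reflexive (cong suc (*-zeroʳ (b ∸ 1)))
  1+[b∸1]*m≤b^m (suc m) = begin
    1 + (b ∸ 1) * suc m        ≡⟨ cong suc (trans (*-suc (b ∸ 1) m) (+-comm (b ∸ 1) _)) ⟩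
    1 + (b ∸ 1) * m + (b ∸ 1)  ≤⟨ +-monoˡ-≤ (b ∸ 1) (1+[b∸1]*m≤b^m m) ⟩
    b ^ m + (b ∸ 1)            ≤⟨ b^m+[b∸1]≤b^[1+m] m ⟩
    b ^ suc m                  ∎
    where open ≤-Reasoning

  1+[b∸1]*[1+m]≤b^m : ∀ m → 2 ≤ m → 1 + (b ∸ 1) * suc m ≤ b ^ m
  1+[b∸1]*[1+m]≤b^m (suc zero) (s≤s ())
  1+[b∸1]*[1+m]≤b^m (suc (suc zero)) _ = begin
    1 + (b ∸ 1) * 3              ≤⟨ m≤m+n _ (a * suc a) ⟩
    1 + (b ∸ 1) * 3 + a * suc a  ≡⟨ lem a ⟩
    b ^ 2                        ∎
    where
    open ≤-Reasoning
    lem : ∀ a → 1 + suc a * 3 + a * suc a ≡ suc (suc a) * (suc (suc a) * 1)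
    lem = solve-∀
  1+[b∸1]*[1+m]≤b^m (suc (suc (suc m))) _ = begin
    1 + (b ∸ 1) * suc (suc (suc (suc m)))      ≡⟨ cong suc (trans (*-suc (b ∸ 1) _) (+-comm (b ∸ 1) _)) ⟩
    1 + (b ∸ 1) * suc (suc (suc m)) + (b ∸ 1)  ≤⟨ +-monoˡ-≤ (b ∸ 1)
                                                    (1+[b∸1]*[1+m]≤b^m (suc (suc m)) (s≤s (s≤s z≤n))) ⟩
    b ^ suc (suc m) + (b ∸ 1)                  ≤⟨ b^m+[b∸1]≤b^[1+m] (suc (suc m)) ⟩
    b ^ suc (suc (suc m))                      ∎
    where open ≤-Reasoning

  -- The map f on blocks of b^m consecutive numbers

  v≤f : ∀ v → v ≤ f b v
  v≤f v = m≤m+n v (s b v)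

  v<f : ∀ {v} → 0 < v → v < f b v
  v<f v>0 = m<m+n _ (s>0 v>0)

  f-digit : ∀ {r} → r < b ^ 1 → f b r ≡ r + r
  f-digit {r} r<b¹ = cong (r +_) (s-digit (subst (r <_) (*-identityʳ b) r<b¹))

  f-digit-injective : ∀ {i j} → i < b ^ 1 → j < b ^ 1 → f b i ≡ f b j → i ≡ j
  f-digit-injective {i} {j} i<b¹ j<b¹ fi≡fj = *-cancelˡ-≡ i j 2 (begin
    2 * i  ≡⟨ cong (i +_) (+-identityʳ i) ⟩
    i + i  ≡⟨ f-digit i<b¹ ⟨
    f b i  ≡⟨ fi≡fj ⟩
    f b j  ≡⟨ f-digit j<b¹ ⟩
    j + j  ≡⟨ cong (j +_) (+-identityʳ j) ⟨
    2 * j  ∎)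
    where open ≡-Reasoning

  f<b^m+b^m : ∀ m {w} → w < b ^ m → f b w < b ^ m + b ^ m
  f<b^m+b^m m {w} w<b^m = +-mono-< w<b^m (<-≤-trans (s≤s (s≤[b∸1]*m m w<b^m)) (1+[b∸1]*m≤b^m m))

  f-concat : ∀ m {q w} → q < b → w < b ^ m → f b (q * b ^ m + w) ≡ q * suc (b ^ m) + f b w
  f-concat m {q} {w} q<b w<b^m = begin
    q * b ^ m + w + s b (q * b ^ m + w)  ≡⟨ cong (q * b ^ m + w +_) s[qbᵐ+w] ⟩
    q * b ^ m + w + (q + s b w)          ≡⟨ lem q (b ^ m) w (s b w) ⟩
    q * suc (b ^ m) + (w + s b w)        ∎
    where
    open ≡-Reasoning
    s[qbᵐ+w] : s b (q * b ^ m + w) ≡ q + s b w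
    s[qbᵐ+w] = trans (s-concat m q w<b^m) (cong (_+ s b w) (s-digit q<b))
    lem : ∀ q p w x → q * p + w + (q + x) ≡ q * suc p + (w + x)
    lem = solve-∀

  divide-b^m : ∀ m v → ∃₂ λ q w → w < b ^ m × q * b ^ m + w ≡ v
  divide-b^m m v = v / bᵐ , v % bᵐ , m%n<n v bᵐ , sym (trans (m≡m%n+[m/n]*n v bᵐ) (+-comm (v % bᵐ) _))
    where
    bᵐ : ℕ
    bᵐ = b ^ m
    instance
      bᵐ≢0 : NonZero bᵐ
      bᵐ≢0 = >-nonZero (b^m>0 m)

  f-below : ∀ m {q v} → q ≤ b → v < q * b ^ m → f b v < suc q * suc (b ^ m)
  f-below m {q} {v} q≤b v<qP with divide-b^m m v
  ... | q′ , w , w<P , refl = begin-strict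
    f b (q′ * P + w)              ≡⟨ f-concat m (<-≤-trans q′<q q≤b) w<P ⟩
    q′ * suc P + f b w            <⟨ +-monoʳ-< (q′ * suc P) fw<2[1+P] ⟩
    q′ * suc P + (suc P + suc P)  ≡⟨ lem q′ (suc P) ⟩
    suc (suc q′) * suc P          ≤⟨ *-monoˡ-≤ (suc P) (s≤s q′<q) ⟩
    suc q * suc P                 ∎
    where
    open ≤-Reasoning
    P : ℕ
    P = b ^ m
    q′<q : q′ < q
    q′<q = *-cancelʳ-< P q′ q (≤-<-trans (m≤m+n (q′ * P) w) v<qP)
    fw<2[1+P] : f b w < suc P + suc P
    fw<2[1+P] = <-≤-trans (f<b^m+b^m m w<P) (+-mono-≤ (n≤1+n P) (n≤1+n P))
    lem : ∀ x y → x * y + (y + y) ≡ suc (suc x) * y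
    lem = solve-∀

  f-above : ∀ m {q v} → q * b ^ m ≤ v → q * suc (b ^ m) ≤ f b v ⊎ b * b ^ m < f b v
  f-above m {q} {v} qP≤v with divide-b^m m v
  ... | q′ , w , w<P , refl with q′ <? b
  ...   | yes q′<b = inj₁ (begin
    q * suc P           ≤⟨ *-monoˡ-≤ (suc P) q≤q′ ⟩
    q′ * suc P          ≤⟨ m≤m+n _ (f b w) ⟩
    q′ * suc P + f b w  ≡⟨ f-concat m q′<b w<P ⟨
    f b (q′ * P + w)    ∎)
    where
    open ≤-Reasoning
    P : ℕ
    P = b ^ m
    v<[1+q′]P : q′ * P + w < suc q′ * P
    v<[1+q′]P = subst (q′ * P + w <_) (+-comm (q′ * P) P) (+-monoʳ-< (q′ * P) w<P)
    q≤q′ : q ≤ q′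
    q≤q′ = <⇒≤pred (*-cancelʳ-< P q (suc q′) (≤-<-trans qP≤v v<[1+q′]P))
  ...   | no  q′≮b = inj₂ (begin-strict
    b * P             ≤⟨ bP≤v ⟩
    q′ * P + w        <⟨ v<f (<-≤-trans (b^m>0 (suc m)) bP≤v) ⟩
    f b (q′ * P + w)  ∎)
    where
    open ≤-Reasoning
    P : ℕ
    P = b ^ m
    bP≤v : b * P ≤ q′ * P + w
    bP≤v = ≤-trans (*-monoˡ-≤ P (≮⇒≥ q′≮b)) (m≤m+n (q′ * P) w)

  -- Counting preimages

  F< : ℕ → ℕ → ℕ
  F< m t = count (λ w → f b w ≟ t) (b ^ m)

  F≡count : ∀ u → F b u ≡ count (λ v → f b v ≟ u) (suc u)
  F≡count u = length-filter-applyUpTo (λ v → f b v ≟ u) id (suc u)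

  f≢below : ∀ {u v} → u < v → f b v ≢ u
  f≢below u<v fv≡u = <⇒≱ u<v (subst (_ ≤_) fv≡u (v≤f _))

  F≡F< : ∀ m {k} → k ≤ b ^ m → F b k ≡ F< m k
  F≡F< m {k} k≤P = begin
    F b k                 ≡⟨ F≡count k ⟩
    count Φ? (suc k)      ≡⟨ count-truncate Φ? (m≤m+n (suc k) P) (λ v k<v _ → f≢below k<v) ⟨
    count Φ? (suc k + P)  ≡⟨ count-truncate Φ? (m≤n+m P (suc k)) (λ v P≤v _ → <⇒≢ (k<f P≤v) ∘ sym) ⟩
    count Φ? P            ∎
    where
    open ≡-Reasoning
    P : ℕ
    P = b ^ m
    Φ? : Decidable (λ v → f b v ≡ k)
    Φ? = λ v → f b v ≟ k
    k<f : ∀ {v} → P ≤ v → k < f b v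
    k<f P≤v = ≤-<-trans (≤-trans k≤P P≤v) (v<f (<-≤-trans (b^m>0 m) P≤v))

  F<₁≤1 : ∀ t → F< 1 t ≤ 1
  F<₁≤1 t = count-≤1 (λ w → f b w ≟ t) (b ^ 1)
    (λ i<b¹ j<b¹ fi≡t fj≡t → f-digit-injective i<b¹ j<b¹ (trans fi≡t (sym fj≡t)))

  F<₁-even : ∀ h → b ≡ h * 2 → ∀ k → F< 1 k + F< 1 (k + suc (b ^ 1)) ≤ 1
  F<₁-even h b≡2h k with F< 1 k ≟ 0 | F< 1 (k + suc (b ^ 1)) ≟ 0
  ... | yes none | _        = subst (λ x → x + F< 1 (k + suc (b ^ 1)) ≤ 1) (sym none) (F<₁≤1 (k + suc (b ^ 1)))
  ... | no  _    | yes none = subst (λ x → F< 1 k + x ≤ 1) (sym none)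
                                (subst (_≤ 1) (sym (+-identityʳ _)) (F<₁≤1 k))
  ... | no  some | no some′ with count≢0⇒∃ (λ w → f b w ≟ k) (b ^ 1) some
                              | count≢0⇒∃ (λ w → f b w ≟ k + suc (b ^ 1)) (b ^ 1) some′
  ...   | w , w<b¹ , fw≡ | w′ , w′<b¹ , fw′≡ = ⊥-elim (even≢odd w′ (w + h) (begin
    2 * w′                   ≡⟨ cong (w′ +_) (+-identityʳ w′) ⟩
    w′ + w′                  ≡⟨ trans (sym (f-digit w′<b¹)) fw′≡ ⟩
    k + suc (b * 1)          ≡⟨ cong₂ (λ x y → x + suc (y * 1)) (trans (sym fw≡) (f-digit w<b¹)) b≡2h ⟩
    w + w + suc (h * 2 * 1)  ≡⟨ lem w h ⟩
    suc (2 * (w + h))        ∎))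
    where
    open ≡-Reasoning
    lem : ∀ w h → w + w + suc (h * 2 * 1) ≡ suc (2 * (w + h))
    lem = solve-∀

  count-block : ∀ m {q u t} → q < b → u ≡ q * suc (b ^ m) + t →
    (o : ℕ → ℕ) → (∀ w → o w ≡ q * b ^ m + w) →
    count (λ w → f b (o w) ≟ u) (b ^ m) ≡ F< m t
  count-block m {q} {u} {t} q<b u≡ o o≡ = count-cong _ _ (b ^ m)
    (λ w w<P fo≡u → +-cancelˡ-≡ (q * suc (b ^ m)) _ _ (trans (sym (f-block w w<P)) (trans fo≡u u≡)))
    (λ w w<P fw≡t → trans (f-block w w<P) (trans (cong (q * suc (b ^ m) +_) fw≡t) (sym u≡)))
    where
    f-block : ∀ w → w < b ^ m → f b (o w) ≡ q * suc (b ^ m) + f b w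
    f-block w w<P = trans (cong (f b) (o≡ w)) (f-concat m q<b w<P)

  -- Of the preimages of u = (c + 1)(P + 1) + k, those below cP and those from (c + 2)P on
  -- miss u; the block of leading digit c contributes F< m (k + P + 1), that of c + 1 F< m k.
  F-split : ∀ m {c k} → 1 ≤ c → c < b → k ≤ b ^ m → c * suc (b ^ m) + k ≤ b * b ^ m →
    F b (c * suc (b ^ m) + k) ≡ F b k + F< m (k + suc (b ^ m))
  F-split m {suc c} {k} _ c<b k≤P u≤bP = begin
    F b u                                            ≡⟨ F≡count u ⟩
    count Φ? (suc u)                                 ≡⟨ count-truncate Φ? u<N (λ v u<v _ → f≢below u<v) ⟨
    count Φ? (c * P + (P + (P + suc u)))             ≡⟨ count-+ Φ? (c * P) _ ⟩
    count Φ? (c * P) + count Φ₁? (P + (P + suc u))   ≡⟨ cong₂ _+_ none-below (count-+ Φ₁? P _) ⟩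
    0 + (count Φ₁? P + count Φ₂? (P + suc u))        ≡⟨ cong (count Φ₁? P +_) (count-+ Φ₂? P (suc u)) ⟩
    count Φ₁? P + (count Φ₂? P + count Φ₃? (suc u))  ≡⟨ cong₂ (λ x y → x + (y + count Φ₃? (suc u)))
                                                          carry-block lead-block ⟩
    F< m (k + suc P) + (F< m k + count Φ₃? (suc u))  ≡⟨ cong (λ x → F< m (k + suc P) + (F< m k + x))
                                                          none-above ⟩
    F< m (k + suc P) + (F< m k + 0)                  ≡⟨ lem (F< m (k + suc P)) (F< m k) ⟩
    F< m k + F< m (k + suc P)                        ≡⟨ cong (_+ F< m (k + suc P)) (F≡F< m k≤P) ⟨
    F b k + F< m (k + suc P)                         ∎
    where
    open ≡-Reasoning
    P : ℕ
    P = b ^ m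
    u : ℕ
    u = suc c * suc P + k
    Φ? : Decidable (λ v → f b v ≡ u)
    Φ? = λ v → f b v ≟ u
    Φ₁? : Decidable (λ i → f b (c * P + i) ≡ u)
    Φ₁? = λ i → Φ? (c * P + i)
    Φ₂? : Decidable (λ i → f b (c * P + (P + i)) ≡ u)
    Φ₂? = λ i → Φ₁? (P + i)
    Φ₃? : Decidable (λ i → f b (c * P + (P + (P + i))) ≡ u)
    Φ₃? = λ i → Φ₂? (P + i)
    u<N : suc u ≤ c * P + (P + (P + suc u))
    u<N = ≤-trans (m≤n+m (suc u) P) (≤-trans (m≤n+m _ P) (m≤n+m _ (c * P)))
    lem : ∀ x y → x + (y + 0) ≡ y + x
    lem = solve-∀
    none-below : count Φ? (c * P) ≡ 0
    none-below = count-none Φ? (c * P) (λ v v<cP →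
      <⇒≢ (<-≤-trans (f-below m (≤-trans (n≤1+n c) (<⇒≤ c<b)) v<cP) (m≤m+n _ k)))
    carry-block : count Φ₁? P ≡ F< m (k + suc P)
    carry-block = count-block m (<-trans (n<1+n c) c<b) (lem₁ c P k) (λ i → c * P + i) (λ _ → refl)
      where
      lem₁ : ∀ c P k → suc c * suc P + k ≡ c * suc P + (k + suc P)
      lem₁ = solve-∀
    lead-block : count Φ₂? P ≡ F< m k
    lead-block = count-block m c<b refl (λ i → c * P + (P + i)) (lem₂ c P)
      where
      lem₂ : ∀ c P i → c * P + (P + i) ≡ suc c * P + i
      lem₂ = solve-∀
    u<[c+2][P+1] : u < suc (suc c) * suc P
    u<[c+2][P+1] = subst (u <_) (+-comm (suc c * suc P) (suc P)) (+-monoʳ-< (suc c * suc P) (s≤s k≤P))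
    f≢above : ∀ {v} → suc (suc c) * P ≤ v → f b v ≢ u
    f≢above {v} [c+2]P≤v =
      [ (λ [c+2][P+1]≤f → <⇒≢ (<-≤-trans u<[c+2][P+1] [c+2][P+1]≤f) ∘ sym)
      , (λ bP<f → <⇒≢ (≤-<-trans u≤bP bP<f) ∘ sym)
      ]′ (f-above m {suc (suc c)} [c+2]P≤v)
    none-above : count Φ₃? (suc u) ≡ 0
    none-above = count-none Φ₃? (suc u) (λ i _ → f≢above (≤-trans (m≤m+n _ i) (≤-reflexive (lem₃ c P i))))
      where
      lem₃ : ∀ c P i → suc (suc c) * P + i ≡ c * P + (P + (P + i))
      lem₃ = solve-∀

  carry-witness : ∀ m {t} → F< m t ≢ 0 → ∃ λ w → w < b ^ m × f b w ≡ t
  carry-witness m {t} = count≢0⇒∃ (λ w → f b w ≟ t) (b ^ m)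

  carry-bound : ∀ m {w k} → w < b ^ m → f b w ≡ k + suc (b ^ m) → k + 2 ≤ (b ∸ 1) * m
  carry-bound m {w} {k} w<P fw≡ = +-cancelʳ-≤ (b ^ m) _ _ (begin
    k + 2 + b ^ m          ≡⟨ lem k (b ^ m) ⟩
    suc (k + suc (b ^ m))  ≡⟨ cong suc fw≡ ⟨
    suc w + s b w          ≤⟨ +-mono-≤ w<P (s≤[b∸1]*m m w<P) ⟩
    b ^ m + (b ∸ 1) * m    ≡⟨ +-comm (b ^ m) _ ⟩
    (b ∸ 1) * m + b ^ m    ∎)
    where
    open ≤-Reasoning
    lem : ∀ k P → k + 2 + P ≡ suc (k + suc P)
    lem = solve-∀

  -- Leading digits

  record LeadingForm (d u : ℕ) : Set where
    field
      lead rest : ℕ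
      1≤lead    : 1 ≤ lead
      lead<b    : lead < b
      rest≤bᵈ   : rest ≤ b ^ d
      u≡        : u ≡ lead * suc (b ^ d) + rest
      carry≢0   : F< d (rest + suc (b ^ d)) ≢ 0

  leading-form : ∀ d {n u} → (∀ k → k ≤ b ^ d → F b k ≢ n) →
    u ≤ b * b ^ d → F b u ≡ n → LeadingForm d u
  leading-form d {n} {u} F≢n u≤bP Fu≡n with divide-suc (b ^ d) u
  ... | zero  , k , k≤P , refl = ⊥-elim (F≢n k k≤P Fu≡n)
  ... | suc c , k , k≤P , refl = record
    { lead = suc c ; rest = k ; 1≤lead = s≤s z≤n ; lead<b = lead<b ; rest≤bᵈ = k≤P ; u≡ = refl
    ; carry≢0 = λ carry≡0 → F≢n k k≤P (F-rest carry≡0) }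
    where
    P : ℕ
    P = b ^ d
    lead<b : suc c < b
    lead<b = *-cancelʳ-< (suc P) (suc c) b (begin-strict
      suc c * suc P      ≤⟨ m≤m+n _ k ⟩
      suc c * suc P + k  ≤⟨ u≤bP ⟩
      b * P              <⟨ *-monoʳ-< b (n<1+n P) ⟩
      b * suc P          ∎)
      where open ≤-Reasoning
    F-rest : F< d (k + suc P) ≡ 0 → F b k ≡ n
    F-rest carry≡0 = begin
      F b k                      ≡⟨ +-identityʳ (F b k) ⟨
      F b k + 0                  ≡⟨ cong (F b k +_) carry≡0 ⟨
      F b k + F< d (k + suc P)   ≡⟨ F-split d (s≤s z≤n) lead<b k≤P u≤bP ⟨
      F b (suc c * suc P + k)    ≡⟨ Fu≡n ⟩
      n                          ∎
      where open ≡-Reasoning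

  rest+2≤ : ∀ {d u} (L : LeadingForm d u) → LeadingForm.rest L + 2 ≤ (b ∸ 1) * d
  rest+2≤ {d} L with carry-witness d (LeadingForm.carry≢0 L)
  ... | w , w<bᵈ , fw≡ = carry-bound d w<bᵈ fw≡

  F-leading : ∀ {d u} (L : LeadingForm d u) → u ≤ b * b ^ d →
    let open LeadingForm L in F b u ≡ F b rest + F< d (rest + suc (b ^ d))
  F-leading {d} L u≤bP =
    trans (cong (F b) u≡) (F-split d 1≤lead lead<b rest≤bᵈ (subst (_≤ b * b ^ d) u≡ u≤bP))
    where open LeadingForm L

  relead : ∀ d {n u} (L : LeadingForm d u) → u ≤ b * b ^ d → F b u ≡ n →
    let open LeadingForm L in
    ∀ {c} → 1 ≤ c → c < b → c * suc (b ^ d) + rest ≤ b * b ^ d → F b (c * suc (b ^ d) + rest) ≡ n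
  relead d L u≤bP Fu≡n 1≤c c<b u′≤bP =
    trans (F-split d 1≤c c<b rest≤bᵈ u′≤bP) (trans (sym (F-leading L u≤bP)) Fu≡n)
    where open LeadingForm L

  F-b^d≢n : ∀ d {n} → 2 ≤ n → (∀ w → w < b ^ d → F b w ≢ n) → F b (b ^ d) ≢ n
  F-b^d≢n zero    2≤n _ F1≡n =
    <⇒≱ (s≤s (subst (_≤ 1) (sym (F≡F< 1 (b^m>0 1))) (F<₁≤1 1))) (subst (2 ≤_) (sym F1≡n) 2≤n)
  -- Lowering the leading digit of b^(m+1) to 1 preserves F and gives a smaller number.
  F-b^d≢n (suc m) 2≤n F≢n Fu≡n =
    [ (λ u₁<u → F≢n u₁ u₁<u (relead m L ≤-refl Fu≡n (s≤s z≤n) 1<b u₁≤u))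
    , u₁≢u
    ]′ (m≤n⇒m<n∨m≡n u₁≤u)
    where
    P : ℕ
    P = b ^ m
    L : LeadingForm m (b * P)
    L = leading-form m (λ k k≤P → F≢n k (≤-<-trans k≤P (^-monoʳ-< b 1<b (n<1+n m)))) ≤-refl Fu≡n
    open LeadingForm L
    u₁ : ℕ
    u₁ = 1 * suc P + rest
    u₁≤u : u₁ ≤ b * P
    u₁≤u = subst (u₁ ≤_) (sym u≡) (+-monoˡ-≤ rest (*-monoˡ-≤ (suc P) 1≤lead))
    u₁≢u : u₁ ≢ b * P
    u₁≢u u₁≡u = <-irrefl refl (begin-strict
      (b ∸ 1) * P  ≡⟨ +-cancelˡ-≡ P _ _ (trans (sym u₁≡u) (lem P rest)) ⟩
      suc rest     <⟨ subst (suc rest <_) (+-comm 2 rest) (n<1+n (suc rest)) ⟩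
      rest + 2     ≤⟨ rest+2≤ L ⟩
      (b ∸ 1) * m  <⟨ 1+[b∸1]*m≤b^m m ⟩
      P            ≤⟨ m≤n*m P (b ∸ 1) ⟩
      (b ∸ 1) * P  ∎)
      where
      open ≤-Reasoning
      lem : ∀ P r → 1 * suc P + r ≡ P + suc r
      lem = solve-∀

  even⇒2≤d : ∀ h → b ≡ h * 2 → ∀ d {n u} → 2 ≤ n →
    (L : LeadingForm d u) → u ≤ b * b ^ d → F b u ≡ n → 2 ≤ d
  even⇒2≤d _ _     zero          _   L _    _    =
    ⊥-elim (n≮0 (≤-trans (m≤n+m 2 _) (≤-trans (rest+2≤ L) (≤-reflexive (*-zeroʳ (b ∸ 1))))))
  even⇒2≤d h b≡2h (suc zero)    {n} {u} 2≤n L u≤bP Fu≡n =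
    ⊥-elim (<⇒≱ (s≤s Fu≤1) (subst (2 ≤_) (sym Fu≡n) 2≤n))
    where
    open LeadingForm L
    Fu≡F<₁+F<₁ : F b u ≡ F< 1 rest + F< 1 (rest + suc (b ^ 1))
    Fu≡F<₁+F<₁ = trans (F-leading L u≤bP) (cong (_+ F< 1 (rest + suc (b ^ 1))) (F≡F< 1 rest≤bᵈ))
    Fu≤1 : F b u ≤ 1
    Fu≤1 = subst (_≤ 1) (sym Fu≡F<₁+F<₁) (F<₁-even h b≡2h rest)
  even⇒2≤d _ _     (suc (suc _)) _   _ _    _    = s≤s (s≤s z≤n)

  lead-bound-odd : ∀ d {c k} → 2 * c ≤ b ∸ 1 → k + 2 ≤ (b ∸ 1) * d →
    c * suc (b ^ d) + k ≤ b * b ^ d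
  lead-bound-odd d {c} {k} 2c≤m k+2≤ = *-cancelˡ-≤ 2 (begin
    2 * (c * suc P + k)        ≡⟨ lem₁ c P k ⟩
    2 * c * suc P + 2 * k      ≤⟨ +-mono-≤ (*-monoˡ-≤ (suc P) 2c≤m) (*-monoʳ-≤ 2 k≤md) ⟩
    m * suc P + 2 * (m * d)    ≡⟨ lem₂ m P (m * d) ⟩
    m * P + (m + 2 * (m * d))  ≤⟨ +-monoʳ-≤ (m * P) (+-mono-≤ m≤mP 2md≤2P) ⟩
    m * P + (m * P + 2 * P)    ≡⟨ lem₃ m P ⟩
    2 * (P + m * P)            ∎)
    where
    open ≤-Reasoning
    P : ℕ
    P = b ^ d
    m : ℕ
    m = b ∸ 1
    k≤md : k ≤ m * d
    k≤md = ≤-trans (m≤m+n k 2) k+2≤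
    m≤mP : m ≤ m * P
    m≤mP = m≤m*n m P {{>-nonZero (b^m>0 d)}}
    2md≤2P : 2 * (m * d) ≤ 2 * P
    2md≤2P = *-monoʳ-≤ 2 (≤-trans (n≤1+n _) (1+[b∸1]*m≤b^m d))
    lem₁ : ∀ c P k → 2 * (c * suc P + k) ≡ 2 * c * suc P + 2 * k
    lem₁ = solve-∀
    lem₂ : ∀ m P x → m * suc P + 2 * x ≡ m * P + (m + 2 * x)
    lem₂ = solve-∀
    lem₃ : ∀ m P → m * P + (m * P + 2 * P) ≡ 2 * (P + m * P)
    lem₃ = solve-∀

  lead-bound-even : ∀ d {c k} → 2 ≤ d → c ≤ b ∸ 1 → k + 2 ≤ (b ∸ 1) * d →
    c * suc (b ^ d) + k ≤ b * b ^ d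
  lead-bound-even d {c} {k} 2≤d c≤m k+2≤ = begin
    c * suc P + k      ≤⟨ +-mono-≤ (*-monoˡ-≤ (suc P) c≤m) (≤-trans (m≤m+n k 2) k+2≤) ⟩
    m * suc P + m * d  ≡⟨ lem m P d ⟩
    m * suc d + m * P  ≤⟨ +-monoˡ-≤ (m * P) (≤-trans (n≤1+n _) (1+[b∸1]*[1+m]≤b^m d 2≤d)) ⟩
    P + m * P          ∎
    where
    open ≤-Reasoning
    P : ℕ
    P = b ^ d
    m : ℕ
    m = b ∸ 1
    lem : ∀ m P d → m * suc P + m * d ≡ m * suc d + m * P
    lem = solve-∀

  -- Choosing the leading digit modulo b − 1

  -- solves is the congruence 2c + 2X ≡ i + 2 (mod b − 1), with its multiples of b − 1 explicit.
  record LeadSolution (i X : ℕ) : Set where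
    field
      c p q    : ℕ
      1≤c      : 1 ≤ c
      c≤b∸1    : c ≤ b ∸ 1
      odd⇒2c≤  : b % 2 ≡ 1 → 2 * c ≤ b ∸ 1
      solves   : 2 * c + 2 * X + p * (b ∸ 1) ≡ i + 2 + q * (b ∸ 1)

  -- h = b/2 is the inverse of 2 modulo b − 1, and y ≡ i − 2X.
  lead-solution-even : ∀ h → b ≡ h * 2 → ∀ i X → LeadSolution i X
  lead-solution-even h b≡2h i X = record
    { c = suc r ; p = 2 * t ; q = 2 * X + y ; 1≤c = s≤s z≤n ; c≤b∸1 = m%n<n (h * y) (b ∸ 1)
    ; odd⇒2c≤ = λ b%2≡1 → ⊥-elim (0≢1+n (trans (sym b%2≡0) b%2≡1))
    ; solves = begin
        2 * suc r + 2 * X + 2 * t * (b ∸ 1)  ≡⟨ lem₁ r t X (b ∸ 1) ⟩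
        2 + 2 * X + 2 * (r + t * (b ∸ 1))    ≡⟨ cong (λ z → 2 + 2 * X + 2 * z) hy≡ ⟨
        2 + 2 * X + 2 * (h * y)              ≡⟨ cong (2 + 2 * X +_) (lem₂ h y) ⟩
        2 + 2 * X + h * 2 * y                ≡⟨ cong (λ z → 2 + 2 * X + z * y) b≡2h ⟨
        2 + 2 * X + b * y                    ≡⟨ lem₃ a i X ⟩
        i + 2 + (2 * X + y) * (b ∸ 1)        ∎ }
    where
    open ≡-Reasoning
    y : ℕ
    y = i + a * (2 * X)
    r : ℕ
    r = (h * y) % (b ∸ 1)
    t : ℕ
    t = (h * y) / (b ∸ 1)
    hy≡ : h * y ≡ r + t * (b ∸ 1)
    hy≡ = m≡m%n+[m/n]*n (h * y) (b ∸ 1)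
    b%2≡0 : b % 2 ≡ 0
    b%2≡0 = trans (cong (_% 2) b≡2h) (m*n%n≡0 h 2)
    lem₁ : ∀ r t X m → 2 * suc r + 2 * X + 2 * t * m ≡ 2 + 2 * X + 2 * (r + t * m)
    lem₁ = solve-∀
    lem₂ : ∀ h y → 2 * (h * y) ≡ h * 2 * y
    lem₂ = solve-∀
    lem₃ : ∀ a i X → 2 + 2 * X + suc (suc a) * (i + a * (2 * X))
                   ≡ i + 2 + (2 * X + (i + a * (2 * X))) * suc a
    lem₃ = solve-∀

  -- With b − 1 = 2g it suffices to solve c + X ≡ i/2 + 1 (mod g), by some c ≤ g.
  lead-solution-odd : ∀ g → b ≡ suc (g * 2) → ∀ i → i % 2 ≡ 0 → ∀ X → LeadSolution i X
  lead-solution-odd zero       ()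
  lead-solution-odd g@(suc g′) b≡2g+1 i i%2≡0 X = record
    { c = suc r ; p = z / g ; q = X ; 1≤c = s≤s z≤n
    ; c≤b∸1 = ≤-trans c≤g (subst (g ≤_) (sym m≡2g) (m≤m*n g 2))
    ; odd⇒2c≤ = λ _ → subst (2 * suc r ≤_) (trans (*-comm 2 g) (sym m≡2g)) (*-monoʳ-≤ 2 c≤g)
    ; solves = begin
        2 * suc r + 2 * X + z / g * (b ∸ 1)  ≡⟨ cong (λ m → 2 * suc r + 2 * X + z / g * m) m≡2g ⟩
        2 * suc r + 2 * X + z / g * (g * 2)  ≡⟨ lem₁ r (z / g) g X ⟩
        2 + 2 * X + 2 * (r + z / g * g)      ≡⟨ cong (λ w → 2 + 2 * X + 2 * w) (m≡m%n+[m/n]*n z g) ⟨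
        2 + 2 * X + 2 * z                    ≡⟨ lem₂ (i / 2) g′ X ⟩
        i / 2 * 2 + 2 + X * (g * 2)          ≡⟨ cong₂ (λ j m → j + 2 + X * m) (n≡n%2+[n/2]*2 i i%2≡0) m≡2g ⟨
        i + 2 + X * (b ∸ 1)                  ∎ }
    where
    open ≡-Reasoning
    m≡2g : b ∸ 1 ≡ g * 2
    m≡2g = suc-injective b≡2g+1
    z : ℕ
    z = i / 2 + g′ * X
    r : ℕ
    r = z % g
    c≤g : suc r ≤ g
    c≤g = m%n<n z g
    lem₁ : ∀ r t g X → 2 * suc r + 2 * X + t * (g * 2) ≡ 2 + 2 * X + 2 * (r + t * g)
    lem₁ = solve-∀
    lem₂ : ∀ j g′ X → 2 + 2 * X + 2 * (j + g′ * X) ≡ j * 2 + 2 + X * (suc g′ * 2)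
    lem₂ = solve-∀

  lead-solution : ∀ {i} → (b % 2 ≡ 1 → i % 2 ≡ 0) → ∀ X → LeadSolution i X
  lead-solution {i} odd⇒even X with n%2≡0⊎n%2≡1 b
  ... | inj₁ even = lead-solution-even (b / 2) (n≡n%2+[n/2]*2 b even) i X
  ... | inj₂ odd  = lead-solution-odd (b / 2) (n≡n%2+[n/2]*2 b odd) i (odd⇒even odd) X

  record ResidueRelead (d n i k : ℕ) : Set where
    field
      c        : ℕ
      1≤c      : 1 ≤ c
      odd⇒2c≤  : b % 2 ≡ 1 → 2 * c ≤ b ∸ 1
      ≤b^[1+d] : c * suc (b ^ d) + k ≤ b * b ^ d
      F≡n      : F b (c * suc (b ^ d) + k) ≡ n
      ≡i       : CongMod (c * suc (b ^ d) + k) i (b ∸ 1)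

  residue-relead : ∀ d {n u i} → 2 ≤ n → i < b ∸ 1 → (b % 2 ≡ 1 → i % 2 ≡ 0) →
    (L : LeadingForm d u) → u ≤ b * b ^ d → F b u ≡ n → ResidueRelead d n i (LeadingForm.rest L)
  residue-relead d {n} {u} {i} 2≤n i<b∸1 odd⇒even L u≤bP Fu≡n
    with carry-witness d (LeadingForm.carry≢0 L)
  ... | w , w<bᵈ , fw≡ = record
    { c = c ; 1≤c = 1≤c ; odd⇒2c≤ = odd⇒2c≤ ; ≤b^[1+d] = bound
    ; F≡n = relead d L u≤bP Fu≡n 1≤c (s≤s c≤b∸1) bound
    ; ≡i = congMod-intro (e + p) (q + c * e + j) i<b∸1 (+-cancelˡ-≡ 2 _ _ residue) }
    where
    open LeadingForm L
    X : ℕ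
    X = s b w
    open LeadSolution (lead-solution {i} odd⇒even X)
    P : ℕ
    P = b ^ d
    m : ℕ
    m = b ∸ 1
    e : ℕ
    e = proj₁ (b^d≡1[mod-b∸1] d)
    j : ℕ
    j = proj₁ (s≡[mod-b∸1] w)
    bound : c * suc P + rest ≤ b * P
    bound =
      [ (λ even → lead-bound-even d {c}
           (even⇒2≤d (b / 2) (n≡n%2+[n/2]*2 b even) d 2≤n L u≤bP Fu≡n) c≤b∸1 (rest+2≤ L))
      , (λ odd → lead-bound-odd d {c} (odd⇒2c≤ odd) (rest+2≤ L))
      ]′ (n%2≡0⊎n%2≡1 b)
    residue : 2 + (c * suc P + rest + (e + p) * m) ≡ 2 + (i + (q + c * e + j) * m)
    residue = begin
      2 + (c * suc P + rest + (e + p) * m)           ≡⟨ lem₀ c P rest e p m ⟩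
      c * suc P + (rest + suc (1 + m * e)) + p * m   ≡⟨ cong (λ x → c * suc P + (rest + suc x) + p * m) P≡ ⟨
      c * suc P + (rest + suc P) + p * m             ≡⟨ cong (λ x → c * suc P + x + p * m) fw≡ ⟨
      c * suc P + (w + X) + p * m                    ≡⟨ cong₂ (λ x y → c * suc x + (y + X) + p * m) P≡ w≡ ⟩
      c * suc (1 + m * e) + (X + m * j + X) + p * m  ≡⟨ lem₁ c m e X j p ⟩
      2 * c + 2 * X + p * m + m * (c * e + j)        ≡⟨ cong (_+ m * (c * e + j)) solves ⟩
      i + 2 + q * m + m * (c * e + j)                ≡⟨ lem₂ i q m c e j ⟩
      2 + (i + (q + c * e + j) * m)                  ∎
      where
      open ≡-Reasoning
      P≡ : P ≡ 1 + m * e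
      P≡ = proj₂ (b^d≡1[mod-b∸1] d)
      w≡ : w ≡ X + m * j
      w≡ = proj₂ (s≡[mod-b∸1] w)
      lem₀ : ∀ c P k e p m → 2 + (c * suc P + k + (e + p) * m) ≡ c * suc P + (k + suc (1 + m * e)) + p * m
      lem₀ = solve-∀
      lem₁ : ∀ c m e X j p → c * suc (1 + m * e) + (X + m * j + X) + p * m
                           ≡ 2 * c + 2 * X + p * m + m * (c * e + j)
      lem₁ = solve-∀
      lem₂ : ∀ i q m c e j → i + 2 + q * m + m * (c * e + j) ≡ 2 + (i + (q + c * e + j) * m)
      lem₂ = solve-∀

theorem4p4 : (b : ℕ) → .{{_ : NonZero b}} → 2 ≤ b →
    (i : ℕ) → InI b i → (n : ℕ) → 2 ≤ n →
    (K Ki B : ℕ) →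
    IsLeast (λ u → F b u ≡ n) K →
    IsLeast (λ u → F b u ≡ n × CongMod u i (b ∸ 1)) Ki →
    IsFloorLog b K B →
    ∃₂ λ c k → 1 ≤ c × c ≤ b ∸ 1 × k + 2 ≤ (b ∸ 1) * B
    × Ki ≡ c * (b ^ B + 1) + k
    × (b % 2 ≡ 1 → 2 * c ≤ b ∸ 1)
theorem4p4 (suc (suc a)) _ i (i<b∸1 , odd⇒even) n 2≤n K Ki d
           (FK≡n , K-least) ((FKi≡n , _) , Ki-least) (bᵈ≤K , K<b^[1+d]) =
  lead , rest , 1≤lead , <⇒≤pred lead<b , rest+2≤ Lᵢ ,
  trans u≡ (cong (λ x → lead * x + rest) (+-comm 1 (b ^ d))) ,
  λ odd → ≤-trans (*-monoʳ-≤ 2 lead≤c) (odd⇒2c≤ odd)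
  where
  open Digits a
  below-bᵈ : ∀ w → w < b ^ d → F b w ≢ n
  below-bᵈ w w<bᵈ = K-least w (<-≤-trans w<bᵈ bᵈ≤K)
  up-to-bᵈ : ∀ k → k ≤ b ^ d → F b k ≢ n
  up-to-bᵈ k k≤bᵈ = [ below-bᵈ k , (λ { refl → F-b^d≢n d 2≤n below-bᵈ }) ]′ (m≤n⇒m<n∨m≡n k≤bᵈ)
  L : LeadingForm d K
  L = leading-form d up-to-bᵈ (<⇒≤ K<b^[1+d]) FK≡n
  open ResidueRelead (residue-relead d 2≤n i<b∸1 odd⇒even L (<⇒≤ K<b^[1+d]) FK≡n)
  u : ℕ
  u = c * suc (b ^ d) + LeadingForm.rest L
  Ki≤u : Ki ≤ u
  Ki≤u = ≮⇒≥ λ u<Ki → Ki-least u u<Ki (F≡n , ≡i)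
  Lᵢ : LeadingForm d Ki
  Lᵢ = leading-form d up-to-bᵈ (≤-trans Ki≤u ≤b^[1+d]) FKi≡n
  open LeadingForm Lᵢ
  lead≤c : lead ≤ c
  lead≤c = lead-≤ (b ^ d) (subst (_≤ u) u≡ Ki≤u) (LeadingForm.rest≤bᵈ L)
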